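{- Let $d,r\ge 0$ be integers and $C\ge 1$ fixed. For real $X\ge 1$ let \[ \mathcal{A}_d=\{(a_0,\dots,a_d)\in\mathbb{Z}^{d+1}: |a_l|\le CX^{d-l}\ (0\le l\le d)\}, \] and for $\mathbf{a}\in\mathcal{A}_d$ let $f_{\mathbf{a}}(t)=a_0+a_1t+\dots+a_dt^d$. Let $y_1,\dots,y_r$ be fixed integers with $1\le y_i\le X$. Then the number of distinct $r$-tuples $(f_{\mathbf{a}}(y_1),\dots,f_{\mathbf{a}}(y_r))$ with $\mathbf{a}\in\mathcal{A}_d$ is $\ll X^{\theta_{d,r}}$, where $\theta_{d,r}=\sum_{l=1}^r\max\{d-l+1,0\}$, and the implicit constant depends only on $d,r,C$.
   Formalization: The constant C and the parameter X take rational values rather than real ones. -}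

module Defs where

open import Data.Nat as ℕ using (ℕ; zero; suc; _∸_)
open import Data.Integer as ℤ using (ℤ)
open import Data.Rational as ℚ using (ℚ; 1ℚ; _*_; _/_)
open import Data.Fin using (Fin; toℕ)
open import Data.Vec using (Vec; lookup)
open import Data.List using (List; length)
open import Data.List.Membership.Propositional using (_∈_)
open import Data.Product using (∃; _×_)

ℤ→ℚ : ℤ → ℚ
ℤ→ℚ z = z / 1

ℕ→ℚ : ℕ → ℚ
ℕ→ℚ n = ℤ→ℚ (ℤ.+ n)

_^ℚ_ : ℚ → ℕ → ℚ
q ^ℚ zero = 1ℚ
q ^ℚ suc n = q * (q ^ℚ n)

sumFinℤ : (n : ℕ) → (Fin n → ℤ) → ℤ
sumFinℤ zero f = ℤ.+ 0
sumFinℤ (suc n) f = f Fin.zero ℤ.+ sumFinℤ n (λ i → f (Fin.suc i))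

evalPoly : {d : ℕ} → Vec ℤ (suc d) → ℤ → ℤ
evalPoly {d} a t = sumFinℤ (suc d) (λ l → lookup a l ℤ.* (t ℤ.^ toℕ l))

InA : (d : ℕ) (C X : ℚ) → Vec ℤ (suc d) → Set
InA d C X a = ∀ (l : Fin (suc d)) → ℚ.∣ ℤ→ℚ (lookup a l) ∣ ℚ.≤ C * (X ^ℚ (d ∸ toℕ l))

-- θ_{d,r} = Σ_{l=1}^r max{d-l+1, 0}
θ : ℕ → ℕ → ℕ
θ d zero = 0
θ d (suc r) = θ d r ℕ.+ (suc d ∸ suc r)

-- the set {x | P x} has at most N elements: it is covered by a list of length ≤ N
-- (i.e. the number of distinct x with P x is ≤ N)
CardAtMost : {A : Set} → (A → Set) → ℚ → Set
CardAtMost {A} P N = ∃ λ (xs : List A) → (ℕ→ℚ (length xs) ℚ.≤ N) × (∀ x → P x → x ∈ xs)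

{-# OPTIONS --safe #-}
module Submission where

-- Write f(t) = f(y₁) + (t - y₁) q(t) by synthetic division.  Then f(y₁) = O(X^d), the
-- quotient q has degree d - 1 and coefficients obeying bounds of the same shape, and each
-- further value f(yᵢ) = f(y₁) + (yᵢ - y₁) q(yᵢ) is determined by f(y₁) and q(yᵢ).  So
-- induction on (d , r) bounds the number of tuples by O(X^d) · O(X^{θ_{d-1,r-1}}), which is
-- O(X^{θ_{d,r}}).  Replacing C and X by integers B ≥ C and X ≤ N ≤ 2X at the outset only
-- changes the constant.

module Horner where
  open import Data.Nat using (zero; suc)
  open import Data.Integer using (ℤ; +_; _+_; _-_; _*_; _^_)
  open import Data.Integer.Properties
    using (*-identityʳ; *-zeroʳ; *-distribˡ-+; *-commutativeSemigroup)
  open import Algebra.Properties.CommutativeSemigroup *-commutativeSemigroup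
    using (x∙yz≈y∙xz)
  open import Data.Integer.Tactic.RingSolver using (solve-∀)
  open import Data.Fin as Fin using (Fin; toℕ)
  open import Data.Vec using (Vec; []; _∷_; lookup; map; zipWith)
  open import Relation.Binary.PropositionalEquality
    using (_≡_; refl; sym; trans; cong; cong₂; module ≡-Reasoning)
  open ≡-Reasoning
  open import Defs using (sumFinℤ; evalPoly)

  horner : ∀ {n} → Vec ℤ n → ℤ → ℤ
  horner []      t = + 0
  horner (a ∷ p) t = a + t * horner p t

  quotient : ∀ {n} → ℤ → Vec ℤ (suc n) → Vec ℤ n
  quotient y (a ∷ [])    = []
  quotient y (a ∷ b ∷ p) = horner (b ∷ p) y ∷ quotient y (b ∷ p)

  horner-quotient : ∀ {n} y t (p : Vec ℤ (suc n)) →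
    horner p t ≡ horner p y + (t - y) * horner (quotient y p) t
  horner-quotient y t (a ∷ []) = linear a t y
    where
    linear : ∀ a t y → a + t * + 0 ≡ (a + y * + 0) + (t - y) * + 0
    linear = solve-∀
  horner-quotient y t (a ∷ b ∷ p) = begin
    a + t * horner (b ∷ p) t                   ≡⟨ cong (λ h → a + t * h) (horner-quotient y t (b ∷ p)) ⟩
    a + t * (e + (t - y) * g)                  ≡⟨ step a t y e g ⟩
    (a + y * e) + (t - y) * (e + t * g)        ∎
    where
    e g : ℤ
    e = horner (b ∷ p) y
    g = horner (quotient y (b ∷ p)) t
    step : ∀ a t y e g → a + t * (e + (t - y) * g) ≡ (a + y * e) + (t - y) * (e + t * g)
    step = solve-∀

  map-horner-quotient : ∀ {n k} y (p : Vec ℤ (suc n)) (zs : Vec ℤ k) →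
    map (horner p) zs ≡ zipWith (λ z w → horner p y + (z - y) * w) zs (map (horner (quotient y p)) zs)
  map-horner-quotient y p []       = refl
  map-horner-quotient y p (z ∷ zs) = cong₂ _∷_ (horner-quotient y z p) (map-horner-quotient y p zs)

  sumFinℤ-cong : ∀ n {f g : Fin n → ℤ} → (∀ i → f i ≡ g i) → sumFinℤ n f ≡ sumFinℤ n g
  sumFinℤ-cong zero    f≗g = refl
  sumFinℤ-cong (suc n) f≗g = cong₂ _+_ (f≗g Fin.zero) (sumFinℤ-cong n (λ i → f≗g (Fin.suc i)))

  sumFinℤ-*ˡ : ∀ n t (f : Fin n → ℤ) → sumFinℤ n (λ i → t * f i) ≡ t * sumFinℤ n f
  sumFinℤ-*ˡ zero    t f = sym (*-zeroʳ t)
  sumFinℤ-*ˡ (suc n) t f = trans (cong (λ s → t * f Fin.zero + s) (sumFinℤ-*ˡ n t (λ i → f (Fin.suc i))))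
                                 (sym (*-distribˡ-+ t (f Fin.zero) _))

  sumFinℤ≡horner : ∀ n (a : Vec ℤ n) t → sumFinℤ n (λ l → lookup a l * t ^ toℕ l) ≡ horner a t
  sumFinℤ≡horner zero    []      t = refl
  sumFinℤ≡horner (suc n) (a ∷ p) t = cong₂ _+_ (*-identityʳ a) (begin
    sumFinℤ n (λ l → lookup p l * (t * t ^ toℕ l))
      ≡⟨ sumFinℤ-cong n (λ l → x∙yz≈y∙xz (lookup p l) t _) ⟩
    sumFinℤ n (λ l → t * (lookup p l * t ^ toℕ l))  ≡⟨ sumFinℤ-*ˡ n t _ ⟩
    t * sumFinℤ n (λ l → lookup p l * t ^ toℕ l)    ≡⟨ cong (t *_) (sumFinℤ≡horner n p t) ⟩
    t * horner p t                                   ∎)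

  evalPoly≡horner : ∀ {d} (a : Vec ℤ (suc d)) t → evalPoly a t ≡ horner a t
  evalPoly≡horner {d} = sumFinℤ≡horner (suc d)

module Counting where
  open import Data.Nat using (ℕ; zero; suc; _+_; _*_; _^_; _∸_; _≤_; NonZero)
  open import Data.Nat.Properties
  open import Algebra.Properties.CommutativeSemigroup *-commutativeSemigroup using (interchange)
  open import Data.Nat.Tactic.RingSolver using (solve-∀)
  open import Data.Integer as ℤ using (ℤ; -[1+_]; ∣_∣)
  import Data.Integer.Properties as ℤ
  open import Data.Fin as Fin using (toℕ)
  open import Data.Vec using (Vec; []; _∷_; lookup; map; zipWith)
  open import Data.List using (List; []; _∷_; [_]; _++_; length; cartesianProductWith)
    renaming (map to map′)
  import Data.List.Properties as List
  open import Data.List.Membership.Propositional using (_∈_)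
  open import Data.List.Membership.Propositional.Properties using (∈-cartesianProductWith⁺)
  open import Data.List.Relation.Unary.Any using (here; there)
  open import Data.Product using (∃; _×_; _,_)
  open import Relation.Nullary using (yes; no)
  open import Relation.Binary.PropositionalEquality
    using (_≡_; refl; sym; trans; cong; cong₂; subst; module ≡-Reasoning)
  open import Defs using (θ)
  open Horner

  Bounded : ∀ {n} → ℕ → ℕ → Vec ℤ n → Set
  Bounded {n} B N p = ∀ l → ∣ lookup p l ∣ ≤ B * N ^ (n ∸ suc (toℕ l))

  Bounded-mono : ∀ {n B B′} N → B ≤ B′ → (p : Vec ℤ n) → Bounded B N p → Bounded B′ N p
  Bounded-mono {n} N B≤B′ p h l = ≤-trans (h l) (*-monoˡ-≤ (N ^ (n ∸ suc (toℕ l))) B≤B′)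

  ∣horner∣≤ : ∀ {k} B N y → ∣ y ∣ ≤ N → (p : Vec ℤ (suc k)) → Bounded B N p →
    ∣ horner p y ∣ ≤ suc k * B * N ^ k
  ∣horner∣≤ B N y ∣y∣≤N (a ∷ []) h = begin
    ∣ a ℤ.+ y ℤ.* ℤ.+ 0 ∣
      ≡⟨ cong ∣_∣ (trans (cong (λ w → a ℤ.+ w) (ℤ.*-zeroʳ y)) (ℤ.+-identityʳ a)) ⟩
    ∣ a ∣                  ≤⟨ h Fin.zero ⟩
    B * 1                  ≡⟨ cong (_* 1) (sym (+-identityʳ B)) ⟩
    1 * B * 1              ∎
    where open ≤-Reasoning
  ∣horner∣≤ {suc k} B N y ∣y∣≤N (a ∷ p) h = begin
    ∣ a ℤ.+ y ℤ.* horner p y ∣                 ≤⟨ ℤ.∣i+j∣≤∣i∣+∣j∣ a _ ⟩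
    ∣ a ∣ + ∣ y ℤ.* horner p y ∣               ≡⟨ cong (∣ a ∣ +_) (ℤ.∣i*j∣≡∣i∣*∣j∣ y _) ⟩
    ∣ a ∣ + ∣ y ∣ * ∣ horner p y ∣             ≤⟨ +-mono-≤ (h Fin.zero) (*-mono-≤ ∣y∣≤N ∣p[y]∣≤) ⟩
    B * (N * N ^ k) + N * (suc k * B * N ^ k)  ≡⟨ collect B N k (N ^ k) ⟩
    suc (suc k) * B * (N * N ^ k)              ∎
    where
    open ≤-Reasoning
    ∣p[y]∣≤ : ∣ horner p y ∣ ≤ suc k * B * N ^ k
    ∣p[y]∣≤ = ∣horner∣≤ B N y ∣y∣≤N p (λ l → h (Fin.suc l))
    collect : ∀ B N k P → B * (N * P) + N * (suc k * B * P) ≡ suc (suc k) * B * (N * P)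
    collect = solve-∀

  quotient-bounded : ∀ {n} B N y → ∣ y ∣ ≤ N → (p : Vec ℤ (suc n)) → Bounded B N p →
    Bounded (n * B) N (quotient y p)
  quotient-bounded B N y ∣y∣≤N (a ∷ [])    h ()
  quotient-bounded {suc k} B N y ∣y∣≤N (a ∷ p@(_ ∷ _)) h = λ
    { Fin.zero    → ∣horner∣≤ B N y ∣y∣≤N p h′
    ; (Fin.suc l) → Bounded-mono N (m≤n+m (k * B) B) (quotient y p)
                      (quotient-bounded B N y ∣y∣≤N p h′) l
    }
    where
    h′ : Bounded B N p
    h′ l = h (Fin.suc l)

  ball : ℕ → List ℤ
  ball zero    = [ ℤ.+ 0 ]
  ball (suc M) = ℤ.+ suc M ∷ -[1+ M ] ∷ ball M

  length-ball : ∀ M → length (ball M) ≡ suc (2 * M)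
  length-ball zero    = refl
  length-ball (suc M) = cong suc (trans (cong suc (length-ball M)) (sym (*-suc 2 M)))

  ∈-ball : ∀ M z → ∣ z ∣ ≤ M → z ∈ ball M
  ∈-ball zero    (ℤ.+ zero) _ = here refl
  ∈-ball (suc M) (ℤ.+ n)    ∣z∣≤1+M with n ≟ suc M
  ... | yes refl = here refl
  ... | no  n≢1+M = there (there (∈-ball M (ℤ.+ n) (m<1+n⇒m≤n (≤∧≢⇒< ∣z∣≤1+M n≢1+M))))
  ∈-ball (suc M) -[1+ n ]   ∣z∣≤1+M with n ≟ M
  ... | yes refl = there (here refl)
  ... | no  n≢M  = there (there (∈-ball M -[1+ n ] (≤∧≢⇒< (≤-pred ∣z∣≤1+M) n≢M)))

  length-cartesianProductWith : ∀ {A B C : Set} (f : A → B → C) xs ys →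
    length (cartesianProductWith f xs ys) ≡ length xs * length ys
  length-cartesianProductWith f []       ys = refl
  length-cartesianProductWith f (x ∷ xs) ys = begin
    length (map′ (f x) ys ++ cartesianProductWith f xs ys)  ≡⟨ List.length-++ (map′ (f x) ys) ⟩
    length (map′ (f x) ys) + length (cartesianProductWith f xs ys)
      ≡⟨ cong₂ _+_ (List.length-map (f x) ys) (length-cartesianProductWith f xs ys) ⟩
    length ys + length xs * length ys                        ∎
    where open ≡-Reasoning

  θ-zero : ∀ r → θ 0 r ≡ 0
  θ-zero zero    = refl
  θ-zero (suc r) = cong₂ _+_ (θ-zero r) (0∸n≡0 r)

  θ-suc-suc : ∀ d r → θ (suc d) (suc r) ≡ suc d + θ d r
  θ-suc-suc d zero    = sym (+-identityʳ (suc d))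
  θ-suc-suc d (suc r) = trans (cong (_+ (d ∸ r)) (θ-suc-suc d r)) (+-assoc (suc d) (θ d r) (d ∸ r))

  θ′ : ℕ → ℕ → ℕ
  θ′ zero    r       = 0
  θ′ (suc n) zero    = 0
  θ′ (suc n) (suc r) = n + θ′ n r

  θ′-suc : ∀ d r → θ′ (suc d) r ≡ θ d r
  θ′-suc d       zero    = refl
  θ′-suc zero    (suc r) = sym (θ-zero (suc r))
  θ′-suc (suc d) (suc r) = trans (cong (suc d +_) (θ′-suc d r)) (sym (θ-suc-suc d r))

  K : ℕ → ℕ → ℕ → ℕ
  K zero    r       B = 1
  K (suc n) zero    B = 1
  K (suc n) (suc r) B = suc (2 * (suc n * B)) * K n r (n * B)

  valueEnumeration : ∀ n r B N .{{_ : NonZero N}} (ys : Vec ℤ r) → (∀ i → ∣ lookup ys i ∣ ≤ N) →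
    ∃ λ (vs : List (Vec ℤ r)) → length vs ≤ K n r B * N ^ θ′ n r ×
      (∀ (p : Vec ℤ n) → Bounded B N p → map (horner p) ys ∈ vs)
  valueEnumeration zero    r       B N ys _ = [ map (horner []) ys ] , ≤-refl , λ { [] _ → here refl }
  valueEnumeration (suc n) zero    B N [] _ = [ [] ] , ≤-refl , λ _ _ → here refl
  valueEnumeration (suc n) (suc r) B N (y ∷ ys) ∣ys∣≤N
    with valueEnumeration n r (n * B) N ys (λ i → ∣ys∣≤N (Fin.suc i))
  ... | vs , |vs|≤ , ∈vs = extensions , |extensions|≤ , ∈extensions
    where
    M : ℕ
    M = suc n * B * N ^ n

    ∣y∣≤N : ∣ y ∣ ≤ N
    ∣y∣≤N = ∣ys∣≤N Fin.zero

    extend : ℤ → Vec ℤ r → Vec ℤ (suc r)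
    extend v ws = v ∷ zipWith (λ z w → v ℤ.+ (z ℤ.- y) ℤ.* w) ys ws

    extensions : List (Vec ℤ (suc r))
    extensions = cartesianProductWith extend (ball M) vs

    ∈extensions : ∀ p → Bounded B N p → map (horner p) (y ∷ ys) ∈ extensions
    ∈extensions p bp =
      subst (_∈ extensions) (cong (horner p y ∷_) (sym (map-horner-quotient y p ys)))
      (∈-cartesianProductWith⁺ extend
        (∈-ball M (horner p y) (∣horner∣≤ B N y ∣y∣≤N p bp))
        (∈vs (quotient y p) (quotient-bounded B N y ∣y∣≤N p bp)))

    1+2cP≤[1+2c]P : ∀ c P → 1 ≤ P → suc (2 * (c * P)) ≤ suc (2 * c) * P
    1+2cP≤[1+2c]P c P 1≤P =
      ≤-trans (+-monoˡ-≤ (2 * (c * P)) 1≤P) (≤-reflexive (cong (P +_) (sym (*-assoc 2 c P))))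

    |extensions|≤ : length extensions ≤ K (suc n) (suc r) B * N ^ (n + θ′ n r)
    |extensions|≤ = begin
      length extensions
        ≡⟨ length-cartesianProductWith extend (ball M) vs ⟩
      length (ball M) * length vs
        ≡⟨ cong (_* length vs) (length-ball M) ⟩
      suc (2 * M) * length vs
        ≤⟨ *-mono-≤ (1+2cP≤[1+2c]P (suc n * B) (N ^ n) (m^n>0 N n)) |vs|≤ ⟩
      (c * N ^ n) * (K n r (n * B) * N ^ θ′ n r)
        ≡⟨ interchange c (N ^ n) (K n r (n * B)) (N ^ θ′ n r) ⟩
      (c * K n r (n * B)) * (N ^ n * N ^ θ′ n r)
        ≡⟨ cong (K (suc n) (suc r) B *_) (sym (^-distribˡ-+-* N n (θ′ n r))) ⟩
      K (suc n) (suc r) B * N ^ (n + θ′ n r)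
        ∎
      where
      open ≤-Reasoning
      c : ℕ
      c = suc (2 * (suc n * B))

module RationalBounds where
  open import Data.Nat as ℕ using (ℕ; zero; suc; z≤n)
  import Data.Nat.Properties as ℕ
  open import Data.Nat.DivMod using (_/_; _%_; m≡m%n+[m/n]*n; m%n<n; m/n*n≤m)
  open import Data.Nat.Coprimality using (1-coprimeTo)
  import Data.Nat.Coprimality as Coprime
  open import Data.Integer as ℤ using (ℤ; +_; -[1+_]; +≤+)
  import Data.Integer.Properties as ℤ
  open import Data.Rational using (mkℚ; 0ℚ; 1ℚ; _≤_; _+_; _*_; *≤*; ∣_∣; NonNegative; nonNegative)
  import Data.Rational.Properties as ℚ
  open import Algebra.Bundles using (CommutativeRing)
  open import Algebra.Properties.CommutativeSemiring.Exp
    (CommutativeRing.commutativeSemiring ℚ.+-*-commutativeRing) using (_^_; ^-distrib-*)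
  open import Data.Product using (∃; _×_; _,_)
  open import Relation.Binary.PropositionalEquality
    using (_≡_; refl; sym; trans; cong; cong₂; subst; subst₂; module ≡-Reasoning)
  open import Defs using (ℤ→ℚ; ℕ→ℚ; _^ℚ_)

  ℤ→ℚ≡mkℚ : ∀ z → ℤ→ℚ z ≡ mkℚ z 0 (Coprime.sym (1-coprimeTo ℤ.∣ z ∣))
  ℤ→ℚ≡mkℚ z = ℚ.↥p/↧p≡p (mkℚ z 0 _)

  ℤ→ℚ-mono-≤ : ∀ {a b} → a ℤ.≤ b → ℤ→ℚ a ≤ ℤ→ℚ b
  ℤ→ℚ-mono-≤ {a} {b} a≤b rewrite ℤ→ℚ≡mkℚ a | ℤ→ℚ≡mkℚ b =
    *≤* (subst₂ ℤ._≤_ (sym (ℤ.*-identityʳ a)) (sym (ℤ.*-identityʳ b)) a≤b)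

  ℤ→ℚ-cancel-≤ : ∀ {a b} → ℤ→ℚ a ≤ ℤ→ℚ b → a ℤ.≤ b
  ℤ→ℚ-cancel-≤ {a} {b} a≤b rewrite ℤ→ℚ≡mkℚ a | ℤ→ℚ≡mkℚ b with a≤b
  ... | *≤* a*1≤b*1 = subst₂ ℤ._≤_ (ℤ.*-identityʳ a) (ℤ.*-identityʳ b) a*1≤b*1

  ℤ→ℚ-homo-+ : ∀ a b → ℤ→ℚ (a ℤ.+ b) ≡ ℤ→ℚ a + ℤ→ℚ b
  ℤ→ℚ-homo-+ a b rewrite ℤ→ℚ≡mkℚ a | ℤ→ℚ≡mkℚ b =
    cong ℤ→ℚ (sym (cong₂ ℤ._+_ (ℤ.*-identityʳ a) (ℤ.*-identityʳ b)))

  ℤ→ℚ-homo-* : ∀ a b → ℤ→ℚ (a ℤ.* b) ≡ ℤ→ℚ a * ℤ→ℚ b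
  ℤ→ℚ-homo-* a b rewrite ℤ→ℚ≡mkℚ a | ℤ→ℚ≡mkℚ b = refl

  ∣ℤ→ℚ∣ : ∀ z → ∣ ℤ→ℚ z ∣ ≡ ℕ→ℚ ℤ.∣ z ∣
  ∣ℤ→ℚ∣ z rewrite ℤ→ℚ≡mkℚ z | ℤ→ℚ≡mkℚ (+ ℤ.∣ z ∣) = refl

  ℕ→ℚ-mono-≤ : ∀ {m n} → m ℕ.≤ n → ℕ→ℚ m ≤ ℕ→ℚ n
  ℕ→ℚ-mono-≤ m≤n = ℤ→ℚ-mono-≤ (+≤+ m≤n)

  ℕ→ℚ-cancel-≤ : ∀ {m n} → ℕ→ℚ m ≤ ℕ→ℚ n → m ℕ.≤ n
  ℕ→ℚ-cancel-≤ {m} {n} m≤n with ℤ→ℚ-cancel-≤ {+ m} {+ n} m≤n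
  ... | +≤+ m≤n = m≤n

  ℕ→ℚ-nonNeg : ∀ n → NonNegative (ℕ→ℚ n)
  ℕ→ℚ-nonNeg n = nonNegative (ℕ→ℚ-mono-≤ {0} {n} z≤n)

  ℕ→ℚ-homo-* : ∀ m n → ℕ→ℚ (m ℕ.* n) ≡ ℕ→ℚ m * ℕ→ℚ n
  ℕ→ℚ-homo-* m n = trans (cong ℤ→ℚ (ℤ.pos-* m n)) (ℤ→ℚ-homo-* (+ m) (+ n))

  ℕ→ℚ-homo-^ : ∀ m k → ℕ→ℚ (m ℕ.^ k) ≡ ℕ→ℚ m ^ℚ k
  ℕ→ℚ-homo-^ m zero    = refl
  ℕ→ℚ-homo-^ m (suc k) = trans (ℕ→ℚ-homo-* m (m ℕ.^ k)) (cong (ℕ→ℚ m *_) (ℕ→ℚ-homo-^ m k))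

  ℕ→ℚ-homo-*^ : ∀ a m k → ℕ→ℚ (a ℕ.* m ℕ.^ k) ≡ ℕ→ℚ a * ℕ→ℚ m ^ℚ k
  ℕ→ℚ-homo-*^ a m k = trans (ℕ→ℚ-homo-* a (m ℕ.^ k)) (cong (ℕ→ℚ a *_) (ℕ→ℚ-homo-^ m k))

  ^ℚ≡^ : ∀ p k → p ^ℚ k ≡ p ^ k
  ^ℚ≡^ p zero    = refl
  ^ℚ≡^ p (suc k) = cong (p *_) (^ℚ≡^ p k)

  ^ℚ-distrib-* : ∀ p q k → (p * q) ^ℚ k ≡ p ^ℚ k * q ^ℚ k
  ^ℚ-distrib-* p q k = begin
    (p * q) ^ℚ k     ≡⟨ ^ℚ≡^ (p * q) k ⟩
    (p * q) ^ k      ≡⟨ ^-distrib-* p q k ⟩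
    p ^ k * q ^ k    ≡⟨ sym (cong₂ _*_ (^ℚ≡^ p k) (^ℚ≡^ q k)) ⟩
    p ^ℚ k * q ^ℚ k  ∎
    where open ≡-Reasoning

  ^ℚ-nonNeg : ∀ p .{{_ : NonNegative p}} k → NonNegative (p ^ℚ k)
  ^ℚ-nonNeg p zero    = _
  ^ℚ-nonNeg p (suc k) = ℚ.nonNeg*nonNeg⇒nonNeg p (p ^ℚ k) {{^ℚ-nonNeg p k}}

  1≤⇒0≤ : ∀ {p} → 1ℚ ≤ p → 0ℚ ≤ p
  1≤⇒0≤ = ℚ.≤-trans (ℚ.nonNegative⁻¹ 1ℚ)

  ^ℚ-mono-≤ : ∀ {p q} .{{_ : NonNegative p}} k → p ≤ q → p ^ℚ k ≤ q ^ℚ k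
  ^ℚ-mono-≤         zero    p≤q = ℚ.≤-refl
  ^ℚ-mono-≤ {p} {q} (suc k) p≤q = ℚ.≤-trans
    (ℚ.*-monoʳ-≤-nonNeg (p ^ℚ k) {{^ℚ-nonNeg p k}} p≤q)
    (ℚ.*-monoˡ-≤-nonNeg q {{nonNegative (ℚ.≤-trans (ℚ.nonNegative⁻¹ p) p≤q)}} (^ℚ-mono-≤ k p≤q))

  ℕ-ceiling : ∀ X → 0ℚ ≤ X → ∃ λ n → X ≤ ℕ→ℚ (suc n) × ℕ→ℚ (suc n) ≤ X + 1ℚ
  ℕ-ceiling (mkℚ -[1+ _ ] _ _) (*≤* ())
  ℕ-ceiling X@(mkℚ (+ m) d-1 _) _ = q , X≤1+q , 1+q≤X+1
    where
    d q : ℕ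
    d = suc d-1
    q = m / d

    +*+-mono-≤ : ∀ a b c e → a ℕ.* b ℕ.≤ c ℕ.* e → + a ℤ.* + b ℤ.≤ + c ℤ.* + e
    +*+-mono-≤ a b c e h = subst₂ ℤ._≤_ (ℤ.pos-* a b) (ℤ.pos-* c e) (+≤+ h)

    X≤1+q : X ≤ ℕ→ℚ (suc q)
    X≤1+q = subst (X ≤_) (sym (ℤ→ℚ≡mkℚ (+ suc q))) (*≤* (+*+-mono-≤ m 1 (suc q) d (begin
      m ℕ.* 1            ≡⟨ ℕ.*-identityʳ m ⟩
      m                  ≡⟨ m≡m%n+[m/n]*n m d ⟩
      m % d ℕ.+ q ℕ.* d  ≤⟨ ℕ.+-monoˡ-≤ (q ℕ.* d) (ℕ.<⇒≤ (m%n<n m d)) ⟩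
      suc q ℕ.* d        ∎)))
      where open ℕ.≤-Reasoning

    q≤X : ℕ→ℚ q ≤ X
    q≤X = subst (_≤ X) (sym (ℤ→ℚ≡mkℚ (+ q)))
      (*≤* (+*+-mono-≤ q d m 1 (ℕ.≤-trans (m/n*n≤m m d) (ℕ.≤-reflexive (sym (ℕ.*-identityʳ m))))))

    1+q≤X+1 : ℕ→ℚ (suc q) ≤ X + 1ℚ
    1+q≤X+1 = subst (_≤ X + 1ℚ) (sym 1+q≡q+1) (ℚ.+-monoˡ-≤ 1ℚ q≤X)
      where
      1+q≡q+1 : ℕ→ℚ (suc q) ≡ ℕ→ℚ q + 1ℚ
      1+q≡q+1 = trans (cong ℤ→ℚ (trans (cong +_ (ℕ.+-comm 1 q)) (ℤ.pos-+ q 1)))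
                      (ℤ→ℚ-homo-+ (+ q) (+ 1))

  X+1≤2X : ∀ {X} → 1ℚ ≤ X → X + 1ℚ ≤ ℕ→ℚ 2 * X
  X+1≤2X {X} 1≤X = ℚ.≤-trans (ℚ.+-monoʳ-≤ X 1≤X) (ℚ.≤-reflexive (sym 2X≡X+X))
    where
    2X≡X+X : ℕ→ℚ 2 * X ≡ X + X
    2X≡X+X = trans (ℚ.*-distribʳ-+ X 1ℚ 1ℚ) (cong₂ _+_ (ℚ.*-identityˡ X) (ℚ.*-identityˡ X))

  ∣ℤ∣≤ : ∀ y N → 0ℚ ≤ ℤ→ℚ y → ℤ→ℚ y ≤ ℕ→ℚ N → ℤ.∣ y ∣ ℕ.≤ N
  ∣ℤ∣≤ y N 0≤y y≤N with ℤ→ℚ-cancel-≤ {+ 0} {y} 0≤y | ℤ→ℚ-cancel-≤ {y} {+ N} y≤N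
  ... | +≤+ _ | +≤+ ∣y∣≤N = ∣y∣≤N

  ∣ℤ∣≤B*Nᵏ : ∀ {C X} B N .{{_ : NonNegative X}} z k → C ≤ ℕ→ℚ B → X ≤ ℕ→ℚ N →
    ∣ ℤ→ℚ z ∣ ≤ C * X ^ℚ k → ℤ.∣ z ∣ ℕ.≤ B ℕ.* N ℕ.^ k
  ∣ℤ∣≤B*Nᵏ {C} {X} B N z k C≤B X≤N ∣z∣≤CXᵏ = ℕ→ℚ-cancel-≤ (begin
    ℕ→ℚ ℤ.∣ z ∣          ≡⟨ sym (∣ℤ→ℚ∣ z) ⟩
    ∣ ℤ→ℚ z ∣            ≤⟨ ∣z∣≤CXᵏ ⟩
    C * X ^ℚ k           ≤⟨ ℚ.*-monoʳ-≤-nonNeg (X ^ℚ k) {{^ℚ-nonNeg X k}} C≤B ⟩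
    ℕ→ℚ B * X ^ℚ k       ≤⟨ ℚ.*-monoˡ-≤-nonNeg (ℕ→ℚ B) {{ℕ→ℚ-nonNeg B}} (^ℚ-mono-≤ k X≤N) ⟩
    ℕ→ℚ B * ℕ→ℚ N ^ℚ k   ≡⟨ sym (ℕ→ℚ-homo-*^ B N k) ⟩
    ℕ→ℚ (B ℕ.* N ℕ.^ k)  ∎)
    where open ℚ.≤-Reasoning

  A*Nᵀ≤A*2ᵀ*Xᵀ : ∀ A N T {X} → 1ℚ ≤ X → ℕ→ℚ N ≤ X + 1ℚ →
    ℕ→ℚ (A ℕ.* N ℕ.^ T) ≤ ℕ→ℚ (A ℕ.* 2 ℕ.^ T) * X ^ℚ T
  A*Nᵀ≤A*2ᵀ*Xᵀ A N T {X} 1≤X N≤X+1 = begin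
    ℕ→ℚ (A ℕ.* N ℕ.^ T)             ≡⟨ ℕ→ℚ-homo-*^ A N T ⟩
    ℕ→ℚ A * ℕ→ℚ N ^ℚ T              ≤⟨ ℚ.*-monoˡ-≤-nonNeg (ℕ→ℚ A) {{ℕ→ℚ-nonNeg A}}
                                          (^ℚ-mono-≤ {{ℕ→ℚ-nonNeg N}} T (ℚ.≤-trans N≤X+1 (X+1≤2X 1≤X))) ⟩
    ℕ→ℚ A * (ℕ→ℚ 2 * X) ^ℚ T        ≡⟨ cong (ℕ→ℚ A *_) (^ℚ-distrib-* (ℕ→ℚ 2) X T) ⟩
    ℕ→ℚ A * (ℕ→ℚ 2 ^ℚ T * X ^ℚ T)   ≡⟨ sym (ℚ.*-assoc (ℕ→ℚ A) (ℕ→ℚ 2 ^ℚ T) (X ^ℚ T)) ⟩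
    ℕ→ℚ A * ℕ→ℚ 2 ^ℚ T * X ^ℚ T     ≡⟨ cong (_* X ^ℚ T) (sym (ℕ→ℚ-homo-*^ A 2 T)) ⟩
    ℕ→ℚ (A ℕ.* 2 ℕ.^ T) * X ^ℚ T    ∎
    where open ℚ.≤-Reasoning

open import Defs
open import Data.Nat using (ℕ; suc)
open import Data.Integer using (ℤ)
open import Data.Rational using (ℚ; 1ℚ; _≤_; _*_)
open import Data.Fin using (Fin)
open import Data.Vec using (Vec; lookup; map)
open import Data.Product using (∃; _×_; _,_)
open import Relation.Binary.PropositionalEquality using (_≡_)

import Data.Nat as ℕ
import Data.Integer as ℤ
open import Data.Fin using (toℕ)
open import Data.List using (length)
open import Data.Vec.Properties using (map-cong)
open import Data.List.Membership.Propositional using (_∈_)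
open import Data.Product using (proj₁; proj₂)
import Data.Rational as ℚ
import Data.Rational.Properties as ℚ
open import Relation.Binary.PropositionalEquality using (refl; sym; subst)
open Horner
open Counting
open RationalBounds

ValueTuple : (d : ℕ) (C X : ℚ) {r : ℕ} → Vec ℤ r → Vec ℤ r → Set
ValueTuple d C X ys v = ∃ λ (a : Vec ℤ (suc d)) → InA d C X a × (map (evalPoly a) ys ≡ v)

valueTuples-bounded : ∀ d r B {C X : ℚ} → C ≤ ℕ→ℚ B → 1ℚ ≤ X → (ys : Vec ℤ r) →
  (∀ i → (1ℚ ≤ ℤ→ℚ (lookup ys i)) × (ℤ→ℚ (lookup ys i) ≤ X)) →
  CardAtMost (ValueTuple d C X ys) (ℕ→ℚ (K (suc d) r B ℕ.* 2 ℕ.^ θ d r) * (X ^ℚ θ d r))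
valueTuples-bounded d r B {C} {X} C≤B 1≤X ys 1≤ys≤X
  with ℕ-ceiling X (1≤⇒0≤ 1≤X)
... | n , X≤N , N≤X+1 with valueEnumeration (suc d) r B (suc n) ys ∣ys∣≤N
  where
  ∣ys∣≤N : ∀ i → ℤ.∣ lookup ys i ∣ ℕ.≤ suc n
  ∣ys∣≤N i =
    ∣ℤ∣≤ (lookup ys i) (suc n) (1≤⇒0≤ (proj₁ (1≤ys≤X i))) (ℚ.≤-trans (proj₂ (1≤ys≤X i)) X≤N)
... | vs , |vs|≤ , ∈vs =
  vs , ℚ.≤-trans (ℕ→ℚ-mono-≤ |vs|≤′) (A*Nᵀ≤A*2ᵀ*Xᵀ (K (suc d) r B) (suc n) (θ d r) 1≤X N≤X+1) , covers
  where
  |vs|≤′ : length vs ℕ.≤ K (suc d) r B ℕ.* suc n ℕ.^ θ d r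
  |vs|≤′ = subst (λ e → length vs ℕ.≤ K (suc d) r B ℕ.* suc n ℕ.^ e) (θ′-suc d r) |vs|≤

  covers : ∀ v → ValueTuple d C X ys v → v ∈ vs
  covers _ (a , a∈A , refl) =
    subst (_∈ vs) (map-cong (λ y → sym (evalPoly≡horner a y)) ys) (∈vs a a-bounded)
    where
    a-bounded : Bounded B (suc n) a
    a-bounded l =
      ∣ℤ∣≤B*Nᵏ B (suc n) {{ℚ.nonNegative (1≤⇒0≤ 1≤X)}} (lookup a l) (d ℕ.∸ toℕ l) C≤B X≤N (a∈A l)

lemma3p3 : (d r : ℕ) (C : ℚ) → 1ℚ ≤ C →
    ∃ λ (K : ℕ) → ∀ (X : ℚ) → 1ℚ ≤ X → (ys : Vec ℤ r) →
      (∀ (i : Fin r) → (1ℚ ≤ ℤ→ℚ (lookup ys i)) × (ℤ→ℚ (lookup ys i) ≤ X)) →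
      CardAtMost (λ (v : Vec ℤ r) → ∃ λ (a : Vec ℤ (suc d)) → InA d C X a × (map (evalPoly a) ys ≡ v))
        (ℕ→ℚ K * (X ^ℚ θ d r))
lemma3p3 d r C 1≤C with ℕ-ceiling C (1≤⇒0≤ 1≤C)
... | b , C≤B , _ = K (suc d) r (suc b) ℕ.* 2 ℕ.^ θ d r ,
  λ X 1≤X ys 1≤ys≤X → valueTuples-bounded d r (suc b) C≤B 1≤X ys 1≤ys≤X
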